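{- Let $G$ be a graph and $(u,v,w)$ a triangle in $G$. If $u$, $v$ and $w$ each have degree at least three in $G$, then $G$ does not admit a $3$-rs colouring.
   Context: All graphs are finite, simple and undirected. A $3$-restricted star colouring ($3$-rs colouring) of $G$ is a map $f:V(G)\to\{0,1,2\}$ with $f(x)\neq f(y)$ for every edge $xy$ and with no path $x,y,z$ in $G$ (not necessarily induced) such that $f(y)>f(x)=f(z)$. -}

module Defs where

open import Data.Nat using (ℕ; _≤_; _<_)
open import Data.Fin using (Fin)
open import Data.Bool using (Bool; true; false; T)
open import Data.List using (List; length; filter)
open import Data.List.Base using (allFin)
open import Data.Product using (_×_; Σ)
open import Relation.Binary.PropositionalEquality using (_≡_)
open import Relation.Nullary using (¬_)
open import Relation.Nullary.Decidable using (does)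
open import Relation.Unary using (Decidable)
open import Data.Bool.Properties using (T?)

record Graph : Set where
  field
    n     : ℕ
    adj   : Fin n → Fin n → Bool
    sym   : ∀ x y → adj x y ≡ adj y x
    irrefl : ∀ x → adj x x ≡ false

open Graph public

Adj : (G : Graph) → Fin (n G) → Fin (n G) → Set
Adj G x y = T (adj G x y)

degree : (G : Graph) → Fin (n G) → ℕ
degree G x = length (filter (λ y → T? (adj G x y)) (allFin (n G)))

open import Data.Fin using () renaming (_<_ to _<ᶠ_)

Is3RS : (G : Graph) → (Fin (n G) → Fin 3) → Set
Is3RS G f =
  (∀ x y → Adj G x y → ¬ (f x ≡ f y)) ×
  (∀ x y z → Adj G x y → Adj G y z → ¬ (z ≡ x) →
     ¬ ((f x <ᶠ f y) × (f x ≡ f z)))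

Fin' : Graph → Set
Fin' G = Fin (n G)

Admits3RS : Graph → Set
Admits3RS G = Σ (Fin (n G) → Fin 3) (Is3RS G)

{-# OPTIONS --safe #-}
-- The colours of a triangle are pairwise distinct, so one corner
-- gets the top colour 2. Any two neighbours of a vertex coloured 2 must get
-- different colours (a common colour c < 2 on both would give a forbidden path
-- c, 2, c), and none of them gets colour 2, so such a vertex has at most two
-- neighbours; this contradicts the degree assumption at that corner.
module Submission where

open import Defs
open import Data.Nat using (_≤_; s≤s)
open import Data.Fin using (Fin; zero; suc; fromℕ; _<_)
open import Data.Fin.Properties using (≤fromℕ; ≤∧≢⇒<)
open import Data.List using (List; _∷_; filter; length)
open import Data.List.Base using (allFin)
open import Data.List.Relation.Unary.All using (_∷_)
open import Data.List.Relation.Unary.AllPairs using (_∷_)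
open import Data.List.Relation.Unary.Unique.Propositional using (Unique)
open import Data.List.Relation.Unary.Unique.Propositional.Properties using (filter⁺; allFin⁺)
open import Data.List.Membership.Propositional using (_∈_)
open import Data.List.Membership.Propositional.Properties using (∈-filter⁻)
open import Data.List.Relation.Unary.Any using (here; there)
open import Data.Product using (_×_; _,_; proj₁; proj₂; ∃-syntax)
open import Data.Sum using (_⊎_; inj₁; inj₂; [_,_])
open import Data.Bool using (T)
open import Data.Bool.Properties using (T?)
open import Data.Empty using (⊥-elim)
open import Function using (_∘_)
open import Relation.Nullary using (¬_)
open import Relation.Binary.PropositionalEquality using (_≡_; _≢_; refl; trans; subst)
  renaming (sym to ≡-sym)

three-distinct : ∀ {A : Set} {xs : List A} → Unique xs → 3 ≤ length xs →
  ∃[ a ] ∃[ b ] ∃[ c ] (a ∈ xs × b ∈ xs × c ∈ xs) × (a ≢ b × b ≢ c × a ≢ c)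
three-distinct {xs = a ∷ b ∷ c ∷ _} ((a≢b ∷ a≢c ∷ _) ∷ (b≢c ∷ _) ∷ _) (s≤s (s≤s (s≤s _))) =
  a , b , c , (here refl , there (here refl) , there (there (here refl))) , (a≢b , b≢c , a≢c)

top : Fin 3
top = fromℕ 2

<top : ∀ {p : Fin 3} → p ≢ top → p < top
<top {p} = ≤∧≢⇒< (≤fromℕ p)

three-distinct-hit-top : ∀ {p q r : Fin 3} → p ≢ q → q ≢ r → p ≢ r →
  p ≡ top ⊎ q ≡ top ⊎ r ≡ top
three-distinct-hit-top {suc (suc zero)} _ _ _ = inj₁ refl
three-distinct-hit-top {q = suc (suc zero)} _ _ _ = inj₂ (inj₁ refl)
three-distinct-hit-top {r = suc (suc zero)} _ _ _ = inj₂ (inj₂ refl)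
three-distinct-hit-top {zero} {zero} p≢q _ _ = ⊥-elim (p≢q refl)
three-distinct-hit-top {suc zero} {suc zero} p≢q _ _ = ⊥-elim (p≢q refl)
three-distinct-hit-top {zero} {suc zero} {zero} _ _ p≢r = ⊥-elim (p≢r refl)
three-distinct-hit-top {zero} {suc zero} {suc zero} _ q≢r _ = ⊥-elim (q≢r refl)
three-distinct-hit-top {suc zero} {zero} {zero} _ q≢r _ = ⊥-elim (q≢r refl)
three-distinct-hit-top {suc zero} {zero} {suc zero} _ _ p≢r = ⊥-elim (p≢r refl)

module _ (G : Graph) where

  Adj-sym : ∀ {x y} → Adj G x y → Adj G y x
  Adj-sym {x} {y} = subst T (Graph.sym G x y)

  neighbours : Fin' G → List (Fin' G)
  neighbours x = filter (λ y → T? (adj G x y)) (allFin (n G))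

  ∈-neighbours⇒Adj : ∀ {x y} → y ∈ neighbours x → Adj G x y
  ∈-neighbours⇒Adj {x} = proj₂ ∘ ∈-filter⁻ (λ y → T? (adj G x y)) {xs = allFin (n G)}

  neighbours-unique : ∀ x → Unique (neighbours x)
  neighbours-unique x = filter⁺ (λ y → T? (adj G x y)) {allFin (n G)} (allFin⁺ (n G))

  module _ {f : Fin' G → Fin 3} (rs : Is3RS G f) where

    private
      proper = proj₁ rs
      star   = proj₂ rs

    top-neighbours-distinct : ∀ {a b c} → f a ≡ top → Adj G a b → Adj G a c → b ≢ c →
      f b ≢ f c
    top-neighbours-distinct {a} {b} {c} fa≡top ab ac b≢c fb≡fc =
      star b a c (Adj-sym ab) ac (b≢c ∘ ≡-sym) (fb<fa , fb≡fc)
      where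
      fb<fa : f b < f a
      fb<fa = subst (f b <_) (≡-sym fa≡top)
                (<top (λ fb≡top → proper a b ab (trans fa≡top (≡-sym fb≡top))))

    top-degree<3 : ∀ {a} → f a ≡ top → ¬ (3 ≤ degree G a)
    top-degree<3 {a} fa≡top deg with three-distinct (neighbours-unique a) deg
    ... | b , c , d , (b∈ , c∈ , d∈) , (b≢c , c≢d , b≢d) =
      [ neighbour-not-top b∈ , [ neighbour-not-top c∈ , neighbour-not-top d∈ ] ]
          (three-distinct-hit-top (distinct b∈ c∈ b≢c) (distinct c∈ d∈ c≢d) (distinct b∈ d∈ b≢d))
      where
      distinct : ∀ {x y} → x ∈ neighbours a → y ∈ neighbours a → x ≢ y → f x ≢ f y
      distinct x∈ y∈ = top-neighbours-distinct fa≡top (∈-neighbours⇒Adj x∈) (∈-neighbours⇒Adj y∈)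
      neighbour-not-top : ∀ {x} → x ∈ neighbours a → f x ≢ top
      neighbour-not-top x∈ fx≡top = proper a _ (∈-neighbours⇒Adj x∈) (trans fa≡top (≡-sym fx≡top))

mainTheorem20 : (G : Graph) (u v w : Fin' G) →
    Adj G u v → Adj G v w → Adj G w u →
    3 ≤ degree G u → 3 ≤ degree G v → 3 ≤ degree G w →
    ¬ Admits3RS G
mainTheorem20 G u v w uv vw wu du dv dw (f , rs@(proper , _)) =
  [ (λ fu≡top → top-degree<3 G rs fu≡top du)
  , [ (λ fv≡top → top-degree<3 G rs fv≡top dv)
    , (λ fw≡top → top-degree<3 G rs fw≡top dw) ] ]
    (three-distinct-hit-top (proper u v uv) (proper v w vw) (proper u w (Adj-sym G wu)))
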